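{- Let $c_1=\frac1{50}$ and $n_0=200$. Let $w$ be a word of length $n>n_0$, let $\Delta=\lfloor c_1 n\rfloor$, let $F$ be an $f$-factorization of $w$, and let $g=|F_{[2\Delta+1..n-\Delta]}|$ be the number of middle factors of $F$. Then there is no quasiseed $v$ of $w$ with $\frac{2n}{g}<|v|\le c_1 n$.
   Context: A word $v$ is a cover of a word $y$ if every position of $y$ lies in some occurrence of $v$ in $y$. A subword $v$ of $w$ is a quasiseed of $w$ if $w=xyz$ with $|x|,|z|<|v|$ and $v$ is a cover of $y$. A factorization of $w$ is $F=(f_1,\dots,f_K)$ with $w=f_1\cdots f_K$ and each $f_k$ a subword of $f_1\cdots f_{k-1}$ or a single letter; an $f$-factorization has the minimum number of factors. For an interval $\lambda$ of positions, $F_\lambda$ is the set of factors of $F$ starting and ending within $\lambda$; $[a..b]=\{a,\dots,b\}$. -}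

module Defs where

open import Data.Nat using (ℕ; zero; suc; _+_; _*_; _≤_; _<_; _≤?_; _/_)
open import Data.Bool using (Bool; true; false; _∧_; if_then_else_)
open import Data.List using (List; []; _∷_; _++_; length; take; drop; concat)
open import Data.Product using (Σ; ∃; _×_; _,_)
open import Relation.Binary.PropositionalEquality using (_≡_)
open import Relation.Nullary.Decidable using (⌊_⌋)

-- Words over an arbitrary alphabet A are lists; positions are 1-based in
-- the paper, 0-based here where noted.

Subword : {A : Set} → List A → List A → Set
Subword {A} u w = Σ (List A) λ x → Σ (List A) λ z → w ≡ x ++ u ++ z

OccursAt : {A : Set} → List A → List A → ℕ → Set
OccursAt v y i = (i + length v ≤ length y) × (take (length v) (drop i y) ≡ v)

Cover : {A : Set} → List A → List A → Set
Cover v y = ∀ p → p < length y →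
  Σ ℕ λ i → OccursAt v y i × (i ≤ p) × (p < i + length v)

Quasiseed : {A : Set} → List A → List A → Set
Quasiseed {A} v w =
  Subword v w ×
  (Σ (List A) λ x → Σ (List A) λ y → Σ (List A) λ z →
     (w ≡ x ++ y ++ z) × (length x < length v) × (length z < length v) × Cover v y)

ValidFactors : {A : Set} → List A → List (List A) → Set
ValidFactors prev [] = Data.Unit.Base.⊤ where import Data.Unit.Base
ValidFactors prev (f ∷ fs) =
  ((length f ≡ 1) Data.Sum.⊎ Subword f prev) × ValidFactors (prev ++ f) fs
  where import Data.Sum

IsFactorization : {A : Set} → List A → List (List A) → Set
IsFactorization w F = (concat F ≡ w) × ValidFactors [] F

IsFFactorization : {A : Set} → List A → List (List A) → Set
IsFFactorization {A} w F =
  IsFactorization w F × (∀ (F' : List (List A)) → IsFactorization w F' → length F ≤ length F')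

-- Number of factors of F (whose first factor starts after 'off' letters)
-- that start and end within the 1-based interval [lo..hi]:
-- a factor f preceded by 'off' letters occupies positions off+1 .. off+|f|.
countWithin : {A : Set} → ℕ → ℕ → ℕ → List (List A) → ℕ
countWithin lo hi off [] = 0
countWithin lo hi off (f ∷ fs) =
  (if ⌊ lo ≤? suc off ⌋ ∧ ⌊ off + length f ≤? hi ⌋ then 1 else 0)
  + countWithin lo hi (off + length f) fs

|F[_‥_]| : {A : Set} → ℕ → ℕ → List (List A) → ℕ
|F[ lo ‥ hi ]| F = countWithin lo hi 0 F

module Submission where

-- Let v (with m = |v|) be a quasiseed of w, write Δ = ⌊n/50⌋, a = 2Δ and
-- b = n ∸ Δ, and suppose m ≤ Δ.  Since the uncovered prefix and suffix of w
-- are shorter than m, every position of the window [a, b) lies in an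
-- occurrence of v, and some occurrence of v already ends inside w[0, a).
--
--  * Tiling.  Any interval of length ≤ m inside a region covered by
--    occurrences of v splits into two subwords of v; cutting [a, b) into
--    windows of length m yields a list Q of subwords of v with concat Q =
--    w[a, b) and |Q|·m + 2a ≤ 2(b + m).
--  * Splicing.  Cutting F at positions a and b and replacing its middle by Q
--    gives another factorization of w (every piece of Q is a subword of v,
--    which occurs in w[0, a)).  Minimality of F and a counting argument for
--    the cut show that F has at most |Q| + 1 factors inside [a, b).
--
-- Hence g·m ≤ (|Q| + 1)·m ≤ 2b ≤ 2n, contradicting 2n < g·m.

open import Defs
open import Data.Nat using (ℕ; zero; suc; _+_; _*_; _∸_; _≤_; _<_; _/_; _≤?_; _<?_; z≤n; s≤s; s≤s⁻¹)
open import Data.Nat.Properties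
open import Data.Nat.DivMod using (m*n/n≡m; /-monoˡ-≤; m/n*n≤m)
open import Data.Nat.Tactic.RingSolver using (solve-∀)
open import Data.List using (List; []; _∷_; _++_; length; take; drop; concat)
open import Data.List.Properties using (++-assoc; ++-identityʳ; ++-cancelˡ; take++drop≡id; take-[]; drop-[]; concat-++; length-++)
open import Data.List.Relation.Unary.All using (All; []; _∷_)
open import Data.Product using (Σ; _×_; _,_; proj₁; proj₂)
open import Data.Sum using (_⊎_; inj₁; inj₂)
open import Data.Unit using (tt)
open import Function using (_∘_)
open import Data.Empty using (⊥-elim)
open import Relation.Nullary using (¬_; yes; no)
open import Relation.Binary.PropositionalEquality using (_≡_; refl; sym; trans; cong; cong₂; subst; subst₂; module ≡-Reasoning)

∸-split : ∀ off l d → off + l ≤ d → d ∸ off ≡ l + (d ∸ (off + l))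
∸-split off l d le = begin
  d ∸ off                              ≡⟨ cong (_∸ off) (sym (m+[n∸m]≡n le)) ⟩
  (off + l) + (d ∸ (off + l)) ∸ off    ≡⟨ cong (_∸ off) (+-assoc off l _) ⟩
  off + (l + (d ∸ (off + l))) ∸ off    ≡⟨ m+n∸m≡n off _ ⟩
  l + (d ∸ (off + l))                  ∎
  where open ≡-Reasoning

≤-/ : ∀ k m n .{{_ : Data.Nat.NonZero k}} → k * m ≤ n → m ≤ n / k
≤-/ k m n km≤n =
  subst (_≤ n / k) (m*n/n≡m m k) (/-monoˡ-≤ k (subst (_≤ n) (*-comm k m) km≤n))

positive-factor : ∀ g m N → N < g * m → 1 ≤ m
positive-factor g zero N lt = ⊥-elim (<⇒≱ lt (≤-trans (≤-reflexive (*-zeroʳ g)) z≤n))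
positive-factor g (suc m) N lt = s≤s z≤n

two-times : ∀ Δ → 2 * Δ ≡ Δ + Δ
two-times Δ = cong (Δ +_) (+-identityʳ Δ)

-- Two more pieces of length m move the start of a tiling by m.
two-more-pieces : ∀ k m p → (2 + k) * m + 2 * p ≡ k * m + 2 * (p + m)
two-more-pieces = solve-∀

final-estimate : ∀ Δ m X b → m ≤ Δ → X + 2 * (2 * Δ) ≤ 2 * (b + m) → m + X ≤ 2 * b
final-estimate Δ m X b m≤Δ h = +-cancelʳ-≤ (3 * m) (m + X) (2 * b) (begin
  m + X + 3 * m       ≡⟨ regroup m X ⟩
  X + 2 * (2 * m)     ≤⟨ +-monoʳ-≤ X (*-monoʳ-≤ 2 (*-monoʳ-≤ 2 m≤Δ)) ⟩
  X + 2 * (2 * Δ)     ≤⟨ h ⟩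
  2 * (b + m)         ≡⟨ *-distribˡ-+ 2 b m ⟩
  2 * b + 2 * m       ≤⟨ +-monoʳ-≤ (2 * b) (*-monoˡ-≤ m (n≤1+n 2)) ⟩
  2 * b + 3 * m       ∎)
  where
  open ≤-Reasoning
  regroup : ∀ m X → m + X + 3 * m ≡ X + 2 * (2 * m)
  regroup = solve-∀

module _ {A : Set} where

  -- slice p s L is the segment L[p, s) of L (0-based, s exclusive).
  slice : ℕ → ℕ → List A → List A
  slice p s L = take (s ∸ p) (drop p L)

  take-+ : ∀ i j (L : List A) → take (i + j) L ≡ take i L ++ take j (drop i L)
  take-+ zero j L = refl
  take-+ (suc i) j [] = sym (take-[] j)
  take-+ (suc i) j (x ∷ L) = cong (x ∷_) (take-+ i j L)

  take-slice : ∀ {p s} (L : List A) → p ≤ s → take p L ++ slice p s L ≡ take s L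
  take-slice {p} {s} L p≤s = trans (sym (take-+ p (s ∸ p) L)) (cong (λ k → take k L) (m+[n∸m]≡n p≤s))

  slice-join : ∀ {p s e} (L : List A) → p ≤ s → s ≤ e → slice p s L ++ slice s e L ≡ slice p e L
  slice-join {p} {s} {e} L p≤s s≤e = ++-cancelˡ (take p L) _ _ (begin
    take p L ++ (slice p s L ++ slice s e L)   ≡⟨ sym (++-assoc (take p L) _ _) ⟩
    (take p L ++ slice p s L) ++ slice s e L   ≡⟨ cong (_++ slice s e L) (take-slice L p≤s) ⟩
    take s L ++ slice s e L                    ≡⟨ take-slice L s≤e ⟩
    take e L                                   ≡⟨ sym (take-slice L (≤-trans p≤s s≤e)) ⟩
    take p L ++ slice p e L                    ∎)
    where open ≡-Reasoning

  take-++-≥ : ∀ (f X : List A) k → take (length f + k) (f ++ X) ≡ f ++ take k X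
  take-++-≥ [] X k = refl
  take-++-≥ (x ∷ f) X k = cong (x ∷_) (take-++-≥ f X k)

  drop-++-≥ : ∀ (f X : List A) k → drop (length f + k) (f ++ X) ≡ drop k X
  drop-++-≥ [] X k = refl
  drop-++-≥ (x ∷ f) X k = drop-++-≥ f X k

  take-++-≤ : ∀ k (f X : List A) → k ≤ length f → take k (f ++ X) ≡ take k f
  take-++-≤ zero f X le = refl
  take-++-≤ (suc k) (x ∷ f) X (s≤s le) = cong (x ∷_) (take-++-≤ k f X le)

  drop-++-≤ : ∀ k (f X : List A) → k ≤ length f → drop k (f ++ X) ≡ drop k f ++ X
  drop-++-≤ zero f X le = refl
  drop-++-≤ (suc k) (x ∷ f) X (s≤s le) = drop-++-≤ k f X le

  slice-++ˡ : ∀ p s (x L : List A) → slice (length x + p) (length x + s) (x ++ L) ≡ slice p s L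
  slice-++ˡ p s x L = cong₂ take ([m+n]∸[m+o]≡n∸o (length x) s p) (drop-++-≥ x L p)

  slice-++ʳ : ∀ p s (y z : List A) → s ≤ length y → slice p s (y ++ z) ≡ slice p s y
  slice-++ʳ zero s y z le = take-++-≤ s y z le
  slice-++ʳ (suc p) zero y z le = refl
  slice-++ʳ (suc p) (suc s) (x ∷ y) z (s≤s le) = slice-++ʳ p s y z le

  subword-[] : ∀ (u : List A) → Subword [] u
  subword-[] u = [] , u , refl

  subword-trans : ∀ {a b c : List A} → Subword a b → Subword b c → Subword a c
  subword-trans {a} {b} {c} (x₁ , z₁ , b≡) (x₂ , z₂ , c≡) = x₂ ++ x₁ , z₁ ++ z₂ , (begin
    c                              ≡⟨ c≡ ⟩
    x₂ ++ b ++ z₂                  ≡⟨ cong (λ q → x₂ ++ q ++ z₂) b≡ ⟩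
    x₂ ++ (x₁ ++ a ++ z₁) ++ z₂    ≡⟨ cong (x₂ ++_) (++-assoc x₁ (a ++ z₁) z₂) ⟩
    x₂ ++ x₁ ++ (a ++ z₁) ++ z₂    ≡⟨ cong (λ q → x₂ ++ x₁ ++ q) (++-assoc a z₁ z₂) ⟩
    x₂ ++ x₁ ++ a ++ z₁ ++ z₂      ≡⟨ sym (++-assoc x₂ x₁ _) ⟩
    (x₂ ++ x₁) ++ a ++ z₁ ++ z₂    ∎)
    where open ≡-Reasoning

  subword-extend : ∀ {a u : List A} (q : List A) → Subword a u → Subword a (u ++ q)
  subword-extend {a} q (x , z , u≡) = x , z ++ q ,
    trans (cong (_++ q) u≡) (trans (++-assoc x (a ++ z) q) (cong (x ++_) (++-assoc a z q)))

  subword-take : ∀ k (f : List A) → Subword (take k f) f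
  subword-take k f = [] , drop k f , sym (take++drop≡id k f)

  subword-drop : ∀ k (f : List A) → Subword (drop k f) f
  subword-drop k f = take k f , [] , sym (trans (cong (take k f ++_) (++-identityʳ (drop k f))) (take++drop≡id k f))

  subword-slice : ∀ {t p s e} (L : List A) → t ≤ p → p ≤ s → s ≤ e → Subword (slice p s L) (slice t e L)
  subword-slice {t} {p} {s} {e} L t≤p p≤s s≤e = slice t p L , slice s e L , (begin
    slice t e L                                  ≡⟨ sym (slice-join L t≤p (≤-trans p≤s s≤e)) ⟩
    slice t p L ++ slice p e L                   ≡⟨ cong (slice t p L ++_) (sym (slice-join L p≤s s≤e)) ⟩
    slice t p L ++ slice p s L ++ slice s e L    ∎)
    where open ≡-Reasoning

module _ {A : Set} (v w : List A) where

  Occurrence : ℕ → Set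
  Occurrence t = slice t (t + length v) w ≡ v

  Covering : ℕ → Set
  Covering q = Σ ℕ λ t → Occurrence t × t ≤ q × q < t + length v

  CoveredRegion : ℕ → ℕ → Set
  CoveredRegion lo hi = ∀ q → lo ≤ q → q < hi → Covering q

  subword-occurrence : ∀ {t p s} → Occurrence t → t ≤ p → p ≤ s → s ≤ t + length v →
                       Subword (slice p s w) v
  subword-occurrence occ t≤p p≤s s≤e = subst (Subword _) occ (subword-slice w t≤p p≤s s≤e)

  cover-region : ∀ (x y z : List A) → w ≡ x ++ y ++ z → Cover v y →
                 CoveredRegion (length x) (length x + length y)
  cover-region x y z w≡ cover q x≤q q<hi
    with cover (q ∸ length x) (+-cancelˡ-< (length x) _ _ (subst (_< length x + length y) (sym (m+[n∸m]≡n x≤q)) q<hi))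
  ... | i , (i+m≤y , occ-y) , i≤q′ , q′<i+m = length x + i , occurs , start≤q , q<end
    where
    m : ℕ
    m = length v
    q≡ : length x + (q ∸ length x) ≡ q
    q≡ = m+[n∸m]≡n x≤q
    occurs : slice (length x + i) (length x + i + m) w ≡ v
    occurs = begin
      slice (length x + i) (length x + i + m) w          ≡⟨ cong₂ (slice (length x + i)) (+-assoc (length x) i m) w≡ ⟩
      slice (length x + i) (length x + (i + m)) (x ++ y ++ z) ≡⟨ slice-++ˡ i (i + m) x (y ++ z) ⟩
      slice i (i + m) (y ++ z)                           ≡⟨ slice-++ʳ i (i + m) y z i+m≤y ⟩
      slice i (i + m) y                                  ≡⟨ cong (λ k → take k (drop i y)) (m+n∸m≡n i m) ⟩
      take m (drop i y)                                  ≡⟨ occ-y ⟩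
      v                                                  ∎
      where open ≡-Reasoning
    start≤q : length x + i ≤ q
    start≤q = subst (length x + i ≤_) q≡ (+-monoʳ-≤ (length x) i≤q′)
    q<end : q < length x + i + m
    q<end = subst₂ _<_ q≡ (sym (+-assoc (length x) i m)) (+-monoʳ-< (length x) q′<i+m)

module Tiling {A : Set} (v w : List A) {lo hi : ℕ} (covered : CoveredRegion v w lo hi) where

  m : ℕ
  m = length v

  TwoPieces : ℕ → ℕ → Set
  TwoPieces p e = Σ ℕ λ s → p ≤ s × s ≤ e × Subword (slice p s w) v × Subword (slice s e w) v

  -- Given an occurrence t of v containing p, either w[p, e) is cut at e or at
  -- t + m (using an occurrence t′ containing t + m), or that occurrence t′
  -- still contains p and starts later than t.
  advance : ∀ {p e} → lo ≤ p → p ≤ e → e ≤ hi → e ≤ p + m → (c : Covering v w p) →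
            TwoPieces p e ⊎ Σ (Covering v w p) (λ c′ → proj₁ c < proj₁ c′)
  advance {p} {e} lo≤p p≤e e≤hi e≤p+m (t , occ , t≤p , p<t+m) with e ≤? t + m
  ... | yes e≤t+m = inj₁ (e , p≤e , ≤-refl ,
          subword-occurrence v w occ t≤p p≤e e≤t+m ,
          subword-occurrence v w occ (≤-trans t≤p p≤e) ≤-refl e≤t+m)
  ... | no e≰t+m
    with covered (t + m) (≤-trans lo≤p (<⇒≤ p<t+m)) (<-≤-trans (≰⇒> e≰t+m) e≤hi)
  ...   | t′ , occ′ , t′≤t+m , t+m<t′+m with p <? t′
  ...     | yes p<t′ = inj₁ (t + m , <⇒≤ p<t+m , <⇒≤ (≰⇒> e≰t+m) ,
              subword-occurrence v w occ t≤p (<⇒≤ p<t+m) ≤-refl ,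
              subword-occurrence v w occ′ t′≤t+m (<⇒≤ (≰⇒> e≰t+m)) (≤-trans e≤p+m (+-monoˡ-≤ m (<⇒≤ p<t′))))
  ...     | no p≮t′ = inj₂ ((t′ , occ′ , ≮⇒≥ p≮t′ , <-trans p<t+m t+m<t′+m) , +-cancelʳ-< m t t′ t+m<t′+m)

  -- The occurrence containing p is
  -- advanced until it yields a cut; its start stays ≤ p, which bounds the
  -- number of steps.
  twoPieces : ∀ {p e} → lo ≤ p → p < e → e ≤ hi → e ≤ p + m → TwoPieces p e
  twoPieces {p} {e} lo≤p p<e e≤hi e≤p+m = slide p (covered p lo≤p (<-≤-trans p<e e≤hi)) (m≤n+m p _)
    where
    slide : ∀ k (c : Covering v w p) → p ≤ proj₁ c + k → TwoPieces p e
    slide zero c fuel with advance lo≤p (<⇒≤ p<e) e≤hi e≤p+m c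
    ... | inj₁ cut = cut
    ... | inj₂ ((t′ , _ , t′≤p , _) , t<t′) =
            ⊥-elim (<⇒≱ t<t′ (≤-trans t′≤p (subst (p ≤_) (+-identityʳ _) fuel)))
    slide (suc k) c fuel with advance lo≤p (<⇒≤ p<e) e≤hi e≤p+m c
    ... | inj₁ cut = cut
    ... | inj₂ (c′ , t<t′) =
            slide k c′ (≤-trans fuel (≤-trans (≤-reflexive (+-suc (proj₁ c) k)) (+-monoˡ-≤ k t<t′)))

  -- w[p, b) as a list of subwords of v, at most two per window of length m.
  Tiled : ℕ → ℕ → Set
  Tiled p b = Σ (List (List A)) λ Q →
    All (λ f → Subword f v) Q × concat Q ≡ slice p b w × length Q * m + 2 * p ≤ 2 * (b + m)

  -- Tiling w[p, b) window by window; the fuel k bounds the number of windows.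
  tiling : ∀ k {p b} → 1 ≤ m → b ≤ hi → b ≤ p + k → lo ≤ p → p ≤ b → Tiled p b
  tiling k {p} {b} m≥1 b≤hi fuel lo≤p p≤b with p <? b
  ... | no p≮b = [] , [] ,
          cong (λ j → take j (drop p w)) (sym (m≤n⇒m∸n≡0 (≮⇒≥ p≮b))) ,
          *-monoʳ-≤ 2 (≤-trans p≤b (m≤m+n b m))
  ... | yes p<b with b ≤? p + m
  ...   | yes b≤p+m with twoPieces lo≤p p<b b≤hi b≤p+m
  ...     | s , p≤s , s≤b , left , right =
              slice p s w ∷ slice s b w ∷ [] , left ∷ right ∷ [] ,
              trans (cong (slice p s w ++_) (++-identityʳ _)) (slice-join w p≤s s≤b) ,
              subst (_≤ 2 * (b + m)) (sym (two-more-pieces 0 m p)) (*-monoʳ-≤ 2 (+-monoˡ-≤ m p≤b))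
  tiling k {p} {b} m≥1 b≤hi fuel lo≤p p≤b | yes p<b | no b≰p+m = window k fuel
    where
    p+m<b : p + m < b
    p+m<b = ≰⇒> b≰p+m
    window : ∀ k → b ≤ p + k → Tiled p b
    window zero fuel = ⊥-elim (<⇒≱ p<b (subst (b ≤_) (+-identityʳ p) fuel))
    window (suc k) fuel
      with twoPieces lo≤p p<p+m (≤-trans (<⇒≤ p+m<b) b≤hi) ≤-refl
         | tiling k m≥1 b≤hi fuel′ (≤-trans lo≤p (m≤m+n p m)) (<⇒≤ p+m<b)
      where
      p<p+m : p < p + m
      p<p+m = m<m+n p m≥1
      fuel′ : b ≤ p + m + k
      fuel′ = ≤-trans fuel (≤-trans (≤-reflexive (+-suc p k)) (+-monoˡ-≤ k p<p+m))
    ... | s , p≤s , s≤p+m , left , right | Q , pieces , concat-Q , bound-Q =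
            slice p s w ∷ slice s (p + m) w ∷ Q , left ∷ right ∷ pieces , concat-eq ,
            subst (_≤ 2 * (b + m)) (sym (two-more-pieces (length Q) m p)) bound-Q
      where
      concat-eq : slice p s w ++ slice s (p + m) w ++ concat Q ≡ slice p b w
      concat-eq = begin
        slice p s w ++ slice s (p + m) w ++ concat Q        ≡⟨ cong (λ q → slice p s w ++ slice s (p + m) w ++ q) concat-Q ⟩
        slice p s w ++ slice s (p + m) w ++ slice (p + m) b w ≡⟨ sym (++-assoc (slice p s w) _ _) ⟩
        (slice p s w ++ slice s (p + m) w) ++ slice (p + m) b w ≡⟨ cong (_++ slice (p + m) b w) (slice-join w p≤s s≤p+m) ⟩
        slice p (p + m) w ++ slice (p + m) b w              ≡⟨ slice-join w (m≤m+n p m) (<⇒≤ p+m<b) ⟩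
        slice p b w                                         ∎
        where open ≡-Reasoning

module _ {A : Set} where

  Admissible : List A → List A → Set
  Admissible f prev = (length f ≡ 1) ⊎ Subword f prev

  -- A cut piece of an admissible factor stays admissible: a piece of a single
  -- letter is either that letter or empty, and a piece of a subword is a subword.
  admissible-take : ∀ k {f prev : List A} → Admissible f prev → Admissible (take k f) prev
  admissible-take k {f} (inj₂ f⊑prev) = inj₂ (subword-trans (subword-take k f) f⊑prev)
  admissible-take zero {_ ∷ []} {prev} (inj₁ _) = inj₂ (subword-[] prev)
  admissible-take (suc k) {_ ∷ []} (inj₁ _) = inj₁ (cong (suc ∘ length) (take-[] k))

  admissible-drop : ∀ k {f prev : List A} (q : List A) → Admissible f prev → Admissible (drop k f) (prev ++ q)
  admissible-drop k {f} q (inj₂ f⊑prev) = inj₂ (subword-extend q (subword-trans (subword-drop k f) f⊑prev))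
  admissible-drop zero {_ ∷ []} q (inj₁ _) = inj₁ refl
  admissible-drop (suc k) {_ ∷ []} {prev} q (inj₁ _) = inj₂ (subst (λ d → Subword d (prev ++ q)) (sym (drop-[] k)) (subword-[] (prev ++ q)))

  valid-subwords : ∀ {u prev : List A} (Q : List (List A)) → Subword u prev →
                   All (λ f → Subword f u) Q → ValidFactors prev Q
  valid-subwords [] u⊑prev [] = tt
  valid-subwords (f ∷ Q) u⊑prev (f⊑u ∷ Q⊑u) =
    inj₂ (subword-trans f⊑u u⊑prev) , valid-subwords Q (subword-extend f u⊑prev) Q⊑u

  valid-++ : ∀ prev (X Y : List (List A)) → ValidFactors prev X → ValidFactors (prev ++ concat X) Y →
             ValidFactors prev (X ++ Y)
  valid-++ prev [] Y _ valid-Y = subst (λ P → ValidFactors P Y) (++-identityʳ prev) valid-Y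
  valid-++ prev (f ∷ X) Y (adm , valid-X) valid-Y =
    adm , valid-++ (prev ++ f) X Y valid-X (subst (λ P → ValidFactors P Y) (sym (++-assoc prev f (concat X))) valid-Y)

-- Cutting a factorization at a position.  The factors of F are read with
-- the number off of letters preceding them.

module _ {A : Set} where

  prefixFactors : ℕ → ℕ → List (List A) → List (List A)
  prefixFactors a off [] = []
  prefixFactors a off (f ∷ fs) with off <? a | off + length f ≤? a
  ... | yes _ | yes _ = f ∷ prefixFactors a (off + length f) fs
  ... | yes _ | no _ = take (a ∸ off) f ∷ []
  ... | no _ | _ = []

  suffixFactors : ℕ → ℕ → List (List A) → List (List A)
  suffixFactors b off [] = []
  suffixFactors b off (f ∷ fs) with off + length f ≤? b
  ... | yes _ = suffixFactors b (off + length f) fs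
  ... | no _ = drop (b ∸ off) f ∷ fs

  concat-prefixFactors : ∀ a off (F : List (List A)) →
                         concat (prefixFactors a off F) ≡ take (a ∸ off) (concat F)
  concat-prefixFactors a off [] = sym (take-[] (a ∸ off))
  concat-prefixFactors a off (f ∷ fs) with off <? a | off + length f ≤? a
  ... | yes _ | yes e≤a = begin
    f ++ concat (prefixFactors a (off + length f) fs)    ≡⟨ cong (f ++_) (concat-prefixFactors a (off + length f) fs) ⟩
    f ++ take (a ∸ (off + length f)) (concat fs)         ≡⟨ sym (take-++-≥ f (concat fs) _) ⟩
    take (length f + (a ∸ (off + length f))) (f ++ concat fs) ≡⟨ cong (λ k → take k (f ++ concat fs)) (sym (∸-split off (length f) a e≤a)) ⟩
    take (a ∸ off) (f ++ concat fs)                      ∎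
    where open ≡-Reasoning
  ... | yes _ | no e≰a = trans (++-identityʳ _)
          (sym (take-++-≤ (a ∸ off) f (concat fs) (m≤n+o⇒m∸n≤o a off (<⇒≤ (≰⇒> e≰a)))))
  ... | no off≮a | _ = cong (λ k → take k (concat (f ∷ fs))) (sym (m≤n⇒m∸n≡0 (≮⇒≥ off≮a)))

  concat-suffixFactors : ∀ b off (F : List (List A)) → off ≤ b →
                         concat (suffixFactors b off F) ≡ drop (b ∸ off) (concat F)
  concat-suffixFactors b off [] _ = sym (drop-[] (b ∸ off))
  concat-suffixFactors b off (f ∷ fs) _ with off + length f ≤? b
  ... | yes e≤b = begin
    concat (suffixFactors b (off + length f) fs)         ≡⟨ concat-suffixFactors b (off + length f) fs e≤b ⟩
    drop (b ∸ (off + length f)) (concat fs)              ≡⟨ sym (drop-++-≥ f (concat fs) _) ⟩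
    drop (length f + (b ∸ (off + length f))) (f ++ concat fs) ≡⟨ cong (λ k → drop k (f ++ concat fs)) (sym (∸-split off (length f) b e≤b)) ⟩
    drop (b ∸ off) (f ++ concat fs)                      ∎
    where open ≡-Reasoning
  ... | no e≰b = sym (drop-++-≤ (b ∸ off) f (concat fs) (m≤n+o⇒m∸n≤o b off (<⇒≤ (≰⇒> e≰b))))

  valid-prefixFactors : ∀ a off prev (F : List (List A)) → ValidFactors prev F →
                        ValidFactors prev (prefixFactors a off F)
  valid-prefixFactors a off prev [] _ = tt
  valid-prefixFactors a off prev (f ∷ fs) (adm , valid) with off <? a | off + length f ≤? a
  ... | yes _ | yes _ = adm , valid-prefixFactors a (off + length f) (prev ++ f) fs valid
  ... | yes _ | no _ = admissible-take (a ∸ off) adm , tt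
  ... | no _ | _ = tt

  valid-suffixFactors : ∀ b off prev (F : List (List A)) → off ≤ b → ValidFactors prev F →
                        ValidFactors (prev ++ take (b ∸ off) (concat F)) (suffixFactors b off F)
  valid-suffixFactors b off prev [] _ _ = tt
  valid-suffixFactors b off prev (f ∷ fs) _ (adm , valid) with off + length f ≤? b
  ... | yes e≤b = subst (λ P → ValidFactors P (suffixFactors b (off + length f) fs)) prev≡
                    (valid-suffixFactors b (off + length f) (prev ++ f) fs e≤b valid)
    where
    prev≡ : (prev ++ f) ++ take (b ∸ (off + length f)) (concat fs) ≡ prev ++ take (b ∸ off) (f ++ concat fs)
    prev≡ = trans (++-assoc prev f _) (cong (prev ++_) (trans (sym (take-++-≥ f (concat fs) _))
              (cong (λ k → take k (f ++ concat fs)) (sym (∸-split off (length f) b e≤b)))))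
  ... | no e≰b = admissible-drop k _ adm , subst (λ P → ValidFactors P fs) prev≡ valid
    where
    k : ℕ
    k = b ∸ off
    prev≡ : prev ++ f ≡ (prev ++ take k (f ++ concat fs)) ++ drop k f
    prev≡ = begin
      prev ++ f                                   ≡⟨ cong (prev ++_) (sym (take++drop≡id k f)) ⟩
      prev ++ take k f ++ drop k f                ≡⟨ sym (++-assoc prev (take k f) (drop k f)) ⟩
      (prev ++ take k f) ++ drop k f              ≡⟨ cong (λ q → (prev ++ q) ++ drop k f)
                                                       (sym (take-++-≤ k f (concat fs) (m≤n+o⇒m∸n≤o b off (<⇒≤ (≰⇒> e≰b))))) ⟩
      (prev ++ take k (f ++ concat fs)) ++ drop k f ∎
      where open ≡-Reasoning

module _ {A : Set} where

  countWithin-beyond : ∀ lo b off (F : List (List A)) → b < off → countWithin lo b off F ≡ 0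
  countWithin-beyond lo b off [] _ = refl
  countWithin-beyond lo b off (f ∷ fs) b<off with lo ≤? suc off | off + length f ≤? b
  ... | _ | yes e≤b = ⊥-elim (<⇒≱ b<off (≤-trans (m≤m+n off _) e≤b))
  ... | yes _ | no _ = countWithin-beyond lo b (off + length f) fs (≤-trans b<off (m≤m+n off _))
  ... | no _ | no _ = countWithin-beyond lo b (off + length f) fs (≤-trans b<off (m≤m+n off _))

  -- A factor ending by b is either counted or discarded by suffixFactors.
  suffix+count : ∀ lo b off (F : List (List A)) →
                 length (suffixFactors b off F) + countWithin lo b off F ≤ length F
  suffix+count lo b off [] = z≤n
  suffix+count lo b off (f ∷ fs) with lo ≤? suc off | off + length f ≤? b
  ... | yes _ | yes _ = ≤-trans (≤-reflexive (+-suc _ _)) (s≤s (suffix+count lo b (off + length f) fs))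
  ... | no _ | yes _ = m≤n⇒m≤1+n (suffix+count lo b (off + length f) fs)
  ... | yes _ | no e≰b = ≤-reflexive (trans (cong (suc (length fs) +_) (countWithin-beyond lo b (off + length f) fs (≰⇒> e≰b))) (+-identityʳ _))
  ... | no _ | no e≰b = ≤-reflexive (trans (cong (suc (length fs) +_) (countWithin-beyond lo b (off + length f) fs (≰⇒> e≰b))) (+-identityʳ _))

  -- Cutting F at a ≤ b: the prefix factors, the suffix factors and the
  -- factors within [a+1..b] number at most |F| + 1 (one factor may reach
  -- across the whole window and appear in both cut parts).
  cut-count : ∀ a b off (F : List (List A)) → a ≤ b →
              length (prefixFactors a off F) + length (suffixFactors b off F) + countWithin (suc a) b off F
                ≤ suc (length F)
  cut-count a b off [] _ = z≤n
  cut-count a b off (f ∷ fs) a≤b with off <? a | off + length f ≤? a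
  ... | no _ | _ = m≤n⇒m≤1+n (suffix+count (suc a) b off (f ∷ fs))
  ... | yes _ | no _ = s≤s (suffix+count (suc a) b off (f ∷ fs))
  ... | yes off<a | yes e≤a with off + length f ≤? b | suc a ≤? suc off
  ...   | no e≰b | _ = ⊥-elim (e≰b (≤-trans e≤a a≤b))
  ...   | yes _ | yes 1+a≤1+off = ⊥-elim (<⇒≱ off<a (s≤s⁻¹ 1+a≤1+off))
  ...   | yes _ | no _ = s≤s (cut-count a b (off + length f) fs a≤b)

module _ {A : Set} {w : List A} {F : List (List A)} {a b : ℕ} where

  splice-factorization : IsFactorization w F → a ≤ b → (Q : List (List A)) →
    concat Q ≡ slice a b w → ValidFactors (take a w) Q →
    IsFactorization w (prefixFactors a 0 F ++ Q ++ suffixFactors b 0 F)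
  splice-factorization (concat-F , valid-F) a≤b Q concat-Q valid-Q = concat-F′ , valid-F′
    where
    G H : List (List A)
    G = prefixFactors a 0 F
    H = suffixFactors b 0 F
    concat-G : concat G ≡ take a w
    concat-G = trans (concat-prefixFactors a 0 F) (cong (take a) concat-F)
    concat-H : concat H ≡ drop b w
    concat-H = trans (concat-suffixFactors b 0 F z≤n) (cong (drop b) concat-F)
    concat-F′ : concat (G ++ Q ++ H) ≡ w
    concat-F′ = begin
      concat (G ++ Q ++ H)                   ≡⟨ sym (concat-++ G (Q ++ H)) ⟩
      concat G ++ concat (Q ++ H)            ≡⟨ cong (concat G ++_) (sym (concat-++ Q H)) ⟩
      concat G ++ concat Q ++ concat H       ≡⟨ cong₂ _++_ concat-G (cong₂ _++_ concat-Q concat-H) ⟩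
      take a w ++ slice a b w ++ drop b w    ≡⟨ sym (++-assoc (take a w) _ _) ⟩
      (take a w ++ slice a b w) ++ drop b w  ≡⟨ cong (_++ drop b w) (take-slice w a≤b) ⟩
      take b w ++ drop b w                   ≡⟨ take++drop≡id b w ⟩
      w                                      ∎
      where open ≡-Reasoning
    valid-H : ValidFactors (take a w ++ concat Q) H
    valid-H = subst (λ P → ValidFactors P H)
      (trans (cong (take b) concat-F) (sym (trans (cong (take a w ++_) concat-Q) (take-slice w a≤b))))
      (valid-suffixFactors b 0 [] F z≤n valid-F)
    valid-F′ : ValidFactors [] (G ++ Q ++ H)
    valid-F′ = valid-++ [] G (Q ++ H) (valid-prefixFactors a 0 [] F valid-F)
      (subst (λ P → ValidFactors P (Q ++ H)) (sym concat-G) (valid-++ (take a w) Q H valid-Q valid-H))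

  middle-bound : IsFFactorization w F → a ≤ b → (Q : List (List A)) →
    concat Q ≡ slice a b w → ValidFactors (take a w) Q →
    countWithin (suc a) b 0 F ≤ suc (length Q)
  middle-bound (factorization , minimal) a≤b Q concat-Q valid-Q =
    +-cancelˡ-≤ (#G + #H) _ _ (begin
      #G + #H + countWithin (suc a) b 0 F  ≤⟨ cut-count a b 0 F a≤b ⟩
      suc (length F)                       ≤⟨ s≤s (subst (length F ≤_) length-F′ shorter) ⟩
      suc (#G + (length Q + #H))           ≡⟨ regroup #G (length Q) #H ⟩
      #G + #H + suc (length Q)             ∎)
    where
    open ≤-Reasoning
    #G #H : ℕ
    #G = length (prefixFactors a 0 F)
    #H = length (suffixFactors b 0 F)
    shorter : length F ≤ length (prefixFactors a 0 F ++ Q ++ suffixFactors b 0 F)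
    shorter = minimal _ (splice-factorization factorization a≤b Q concat-Q valid-Q)
    length-F′ : length (prefixFactors a 0 F ++ Q ++ suffixFactors b 0 F) ≡ #G + (length Q + #H)
    length-F′ = trans (length-++ (prefixFactors a 0 F)) (cong (#G +_) (length-++ Q))
    regroup : ∀ g q h → suc (g + (q + h)) ≡ g + h + suc q
    regroup = solve-∀

window-nonempty : ∀ Δ n → 1 ≤ Δ → Δ * 50 ≤ n → 2 * Δ < n ∸ Δ
window-nonempty Δ n Δ≥1 50Δ≤n = m+n≤o⇒m≤o∸n (suc (2 * Δ)) (begin-strict
  2 * Δ + Δ              <⟨ m<m+n (2 * Δ + Δ) (≤-trans (s≤s z≤n) (*-monoˡ-≤ 47 Δ≥1)) ⟩
  2 * Δ + Δ + Δ * 47     ≡⟨ regroup Δ ⟩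
  Δ * 50                 ≤⟨ 50Δ≤n ⟩
  n                      ∎)
  where
  open ≤-Reasoning
  regroup : ∀ Δ → 2 * Δ + Δ + Δ * 47 ≡ Δ * 50
  regroup = solve-∀

border-bounds : ∀ {A : Set} {w : List A} (x y z : List A) {m Δ : ℕ} → w ≡ x ++ y ++ z →
  length x < m → length z < m → m ≤ Δ →
  length x ≤ 2 * Δ × length w ∸ Δ ≤ length x + length y
border-bounds {w = w} x y z {m} {Δ} w≡ x<m z<m m≤Δ =
  ≤-trans (<⇒≤ x<m) (≤-trans m≤Δ (≤-trans (m≤m+n Δ Δ) (≤-reflexive (sym (two-times Δ))))) ,
  m≤n+o⇒m∸n≤o (length w) Δ (begin
    length w                           ≡⟨ cong length w≡ ⟩
    length (x ++ y ++ z)               ≡⟨ length-++ x ⟩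
    length x + length (y ++ z)         ≡⟨ cong (length x +_) (length-++ y) ⟩
    length x + (length y + length z)   ≡⟨ sym (+-assoc (length x) _ _) ⟩
    length x + length y + length z     ≤⟨ +-monoʳ-≤ (length x + length y) (≤-trans (<⇒≤ z<m) m≤Δ) ⟩
    length x + length y + Δ            ≡⟨ +-comm _ Δ ⟩
    Δ + (length x + length y)          ∎)
  where open ≤-Reasoning

middle-factors-bound : ∀ {A : Set} (w : List A) (F : List (List A)) (v : List A) →
  IsFFactorization w F → Quasiseed v w → 1 ≤ length v → 50 * length v ≤ length w →
  |F[ 2 * (length w / 50) + 1 ‥ length w ∸ length w / 50 ]| F * length v ≤ 2 * length w
middle-factors-bound w F v f-fact (_ , x , y , z , w≡ , x<m , z<m , cover) m≥1 50m≤n =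
  estimate (Tiling.tiling v w covered b m≥1 b≤hi (m≤n+m b a) x≤a (<⇒≤ a<b))
  where
  n m Δ a b : ℕ
  n = length w
  m = length v
  Δ = n / 50
  a = 2 * Δ
  b = n ∸ Δ
  m≤Δ : m ≤ Δ
  m≤Δ = ≤-/ 50 m n 50m≤n
  a<b : a < b
  a<b = window-nonempty Δ n (≤-trans m≥1 m≤Δ) (m/n*n≤m n 50)
  covered : CoveredRegion v w (length x) (length x + length y)
  covered = cover-region v w x y z w≡ cover
  x≤a : length x ≤ a
  x≤a = proj₁ (border-bounds x y z w≡ x<m z<m m≤Δ)
  b≤hi : b ≤ length x + length y
  b≤hi = proj₂ (border-bounds x y z w≡ x<m z<m m≤Δ)
  -- The occurrence of v containing the first covered position ends before a.
  v⊑prefix : Subword v (take a w)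
  v⊑prefix = prefix-occurrence (covered (length x) ≤-refl (≤-<-trans x≤a (<-≤-trans a<b b≤hi)))
    where
    prefix-occurrence : Covering v w (length x) → Subword v (take a w)
    prefix-occurrence (t , occ , t≤x , _) = subst (λ u → Subword u (take a w)) occ
      (subword-slice w z≤n (m≤m+n t m) (≤-trans (+-mono-≤ t≤Δ m≤Δ) (≤-reflexive (sym (two-times Δ)))))
      where
      t≤Δ : t ≤ Δ
      t≤Δ = ≤-trans t≤x (≤-trans (<⇒≤ x<m) m≤Δ)
  -- Splicing the tiling of w[a, b) into F bounds the middle factors.
  estimate : Tiling.Tiled v w covered a b → |F[ a + 1 ‥ b ]| F * m ≤ 2 * n
  estimate (Q , pieces , concat-Q , bound-Q) = begin
    |F[ a + 1 ‥ b ]| F * m                ≡⟨ cong (λ l → countWithin l b 0 F * m) (+-comm a 1) ⟩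
    countWithin (suc a) b 0 F * m         ≤⟨ *-monoˡ-≤ m (middle-bound f-fact (<⇒≤ a<b) Q concat-Q
                                               (valid-subwords Q v⊑prefix pieces)) ⟩
    m + length Q * m                      ≤⟨ final-estimate Δ m (length Q * m) b m≤Δ bound-Q ⟩
    2 * b                                 ≤⟨ *-monoʳ-≤ 2 (m∸n≤m n Δ) ⟩
    2 * n                                 ∎
    where open ≤-Reasoning

mainTheorem8 : {A : Set} (w : List A) (F : List (List A)) →
    200 < length w →
    IsFFactorization w F →
    (v : List A) → Quasiseed v w →
    ¬ ((2 * length w < |F[ 2 * (length w / 50) + 1 ‥ length w ∸ length w / 50 ]| F * length v)
    × (50 * length v ≤ length w))
mainTheorem8 w F _ f-fact v quasiseed (2n<gm , 50m≤n) =
  <⇒≱ 2n<gm (middle-factors-bound w F v f-fact quasiseed m≥1 50m≤n)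
  where
  m≥1 : 1 ≤ length v
  m≥1 = positive-factor (|F[ 2 * (length w / 50) + 1 ‥ length w ∸ length w / 50 ]| F) (length v) _ 2n<gm
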